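{- Let $K\leq \mathrm{Aut}(Q_n)$ and let $\ell$ be a positive integer. The following are equivalent: (i) $(Q_n)_K$ is regular of valency $n$ with $a_{i-1}=0$ and $c_i=i$ for $1\leq i\leq \ell$; (ii) $d_K\geq 2\ell+1$.
   Context: The $n$-cube $Q_n$ has vertex set $\mathbb{F}_2^n$, two vectors adjacent iff their Hamming distance is $1$; $\mathrm{Aut}(Q_n)=\mathbb{F}_2^n: S_n$ (translations and coordinate permutations). For $K\leq\mathrm{Aut}(Q_n)$, $d_K:=\min\{d_{Q_n}(x,x^k): x\in\mathbb{F}_2^n,\ 1\neq k\in K\}$ if $K\neq 1$ and $d_K:=\infty$ if $K=1$. The normal quotient $(Q_n)_K$ is the simple graph whose vertices are the $K$-orbits $x^K$ on $\mathbb{F}_2^n$, distinct orbits adjacent iff some vertex of one is adjacent in $Q_n$ to some vertex of the other. For a graph $\Pi$, a vertex $u$ and $i\geq 0$, $\Pi_i(u)$ is the set of vertices at distance $i$ from $u$ and $\Pi(u)=\Pi_1(u)$. For $u,v$ with $d_\Pi(u,v)=i$, $c_i(u,v):=|\Pi_{i-1}(u)\cap\Pi(v)|$ and $a_i(u,v):=|\Pi_i(u)\cap\Pi(v)|$; writing "$c_i=c$" (resp. "$a_i=a$") means $c_i(u,v)=c$ (resp. $a_i(u,v)=a$) for all pairs $u,v$ at distance $i$. -}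

module Defs where

open import Data.Nat using (ℕ; zero; suc; _<_)
open import Data.Bool using (Bool; true; false; _xor_)
open import Data.Fin using (Fin)
open import Data.Fin.Permutation using (Permutation′; _⟨$⟩ʳ_; _⟨$⟩ˡ_; _∘ₚ_; flip; id)
open import Data.Vec using (Vec; []; _∷_; lookup; tabulate; zipWith; replicate)
open import Data.List using (List; length)
open import Data.List.Relation.Unary.All using (All)
open import Data.List.Relation.Unary.Any using (Any)
open import Data.List.Relation.Unary.AllPairs using (AllPairs)
open import Data.Product using (Σ; ∃; _×_)
open import Relation.Binary.PropositionalEquality using (_≡_)
open import Relation.Nullary using (¬_)

Vertex : ℕ → Set
Vertex n = Vec Bool n

-- Hamming distance (= distance in Q_n).
hamming : ∀ {n} → Vertex n → Vertex n → ℕ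
hamming [] [] = 0
hamming (a ∷ x) (b ∷ y) with a xor b
... | true  = suc (hamming x y)
... | false = hamming x y

-- Elements of Aut(Q_n) = F_2^n : S_n : a translation vector and a coordinate permutation.
record Aut (n : ℕ) : Set where
  constructor aut
  field
    tr  : Vec Bool n
    perm : Permutation′ n
open Aut public

act : ∀ {n} → Aut n → Vertex n → Vertex n
act a x = zipWith _xor_ (tabulate (λ i → lookup x (perm a ⟨$⟩ʳ i))) (tr a)

-- Group structure, chosen so that act (a · b) x = act b (act a x).
idA : ∀ {n} → Aut n
idA {n} = aut (replicate n false) id

_·_ : ∀ {n} → Aut n → Aut n → Aut n
a · b = aut (tabulate (λ i → lookup (tr a) (perm b ⟨$⟩ʳ i) xor lookup (tr b) i))
            (perm b ∘ₚ perm a)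

_⁻¹ : ∀ {n} → Aut n → Aut n
a ⁻¹ = aut (tabulate (λ j → lookup (tr a) (perm a ⟨$⟩ˡ j))) (flip (perm a))

_≈A_ : ∀ {n} → Aut n → Aut n → Set
a ≈A b = (tr a ≡ tr b) × (∀ i → perm a ⟨$⟩ʳ i ≡ perm b ⟨$⟩ʳ i)

record Subgroup (n : ℕ) : Set₁ where
  field
    mem    : Aut n → Set
    resp   : ∀ {a b} → a ≈A b → mem a → mem b
    id∈    : mem idA
    mul∈   : ∀ {a b} → mem a → mem b → mem (a · b)
    inv∈   : ∀ {a} → mem a → mem (a ⁻¹)
open Subgroup public

module Quotient {n : ℕ} (K : Subgroup n) where

  -- x and y lie in the same K-orbit (so represent the same vertex of (Q_n)_K).
  _~_ : Vertex n → Vertex n → Set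
  x ~ y = ∃ λ k → mem K k × act k x ≡ y

  -- Adjacency in the normal quotient (Q_n)_K (simple graph: distinct orbits).
  Adj : Vertex n → Vertex n → Set
  Adj x y = ¬ (x ~ y) × Σ (Vertex n) λ x' → Σ (Vertex n) λ y' →
              (x ~ x') × (y ~ y') × (hamming x' y' ≡ 1)

  Walk : ℕ → Vertex n → Vertex n → Set
  Walk zero x y = x ~ y
  Walk (suc k) x y = Σ (Vertex n) λ z → Adj x z × Walk k z y

  Dist : Vertex n → Vertex n → ℕ → Set
  Dist x y i = Walk i x y × (∀ j → j < i → ¬ Walk j x y)

  HasSize : (Vertex n → Set) → ℕ → Set
  HasSize P c = Σ (List (Vertex n)) λ xs → (length xs ≡ c) × All P xs ×
                  AllPairs (λ a b → ¬ (a ~ b)) xs × (∀ y → P y → Any (y ~_) xs)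

  -- Π_{i-1}(u) ∩ Π(v) as a predicate, where i-1 is given as m.
  Layer∩Nbr : Vertex n → Vertex n → ℕ → Vertex n → Set
  Layer∩Nbr u v m w = Dist u w m × Adj v w

  Regular : ℕ → Set
  Regular d = ∀ u → HasSize (Adj u) d

  -- c-succ m c  means  c_{m+1} = c : for all u v at distance m+1, |Π_m(u) ∩ Π(v)| = c.
  c-succ : ℕ → ℕ → Set
  c-succ m c = ∀ u v → Dist u v (suc m) → HasSize (Layer∩Nbr u v m) c

  a-eq : ℕ → ℕ → Set
  a-eq m a = ∀ u v → Dist u v m → HasSize (Layer∩Nbr u v m) a

-- Condition (i): (Q_n)_K is regular of valency n with a_{i-1} = 0 and c_i = i for 1 ≤ i ≤ ℓ
-- (written with i = m+1, so 0 ≤ m, m+1 ≤ ℓ).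
ConditionI : (n : ℕ) → Subgroup n → ℕ → Set
ConditionI n K ℓ = Regular n × (∀ m → suc m Data.Nat.≤ ℓ → a-eq m 0 × c-succ m (suc m))
  where open Quotient K

NonTrivial : ∀ {n} → Aut n → Set
NonTrivial a = ¬ (a ≈A idA)

-- d_K ≥ m  (d_K = min { d(x, x^k) : x, 1 ≠ k ∈ K }, with d_K = ∞ if K = 1).
dK≥ : (n : ℕ) → Subgroup n → ℕ → Set
dK≥ n K m = ∀ (x : Vertex n) (k : Aut n) → mem K k → NonTrivial k → m Data.Nat.≤ hamming x (act k x)

-- If d_K ≥ 2ℓ+1, two distinct vertices within Hamming distance ℓ of a common vertex never lie in
-- one K-orbit.  Hence, up to distance ℓ, the quotient looks exactly like Q_n: the n flips of a
-- vertex represent its n neighbours, a representative at Hamming distance m ≤ ℓ realises the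
-- quotient distance m, and a_{i-1} = 0, c_i = i are read off in Q_n.
--
-- Conversely we show d_K > d by induction on d ≤ 2ℓ.  Suppose k ∈ K moves x by exactly d and
-- let v be the midpoint of a Hamming geodesic from x to x^k.  For d ≤ 2 a vertex and one of its
-- neighbours, or two neighbours of one vertex, fall into a single orbit, contradicting valency n.
-- For d = 2m+1, the neighbour of v
-- towards x^k is at quotient distance m from x^K, so a_m ≠ 0.  For d = 2m+2, the m+1 neighbours
-- of v towards x and the one towards x^k are m+2 distinct orbits at quotient distance m from
-- x^K, so c_{m+1} ≠ m+1.
module Submission where

open import Defs
open import Data.Bool using (Bool; true; false; not; _xor_; if_then_else_)
open import Data.Bool.Properties
  using (xor-assoc; xor-comm; xor-same; xor-identityʳ; not-distribˡ-xor) renaming (_≟_ to _≟ᵇ_)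
open import Data.Fin using (Fin; zero; suc; punchIn)
import Data.Fin.Properties as Fin
open import Data.Fin.Permutation using (Permutation′; _⟨$⟩ʳ_; _⟨$⟩ˡ_; inverseʳ; inverseˡ)
open import Data.List using (List; []; _∷_; length; map; allFin)
open import Data.List.Membership.Propositional using (_∈_; _∉_)
open import Data.List.Membership.Propositional.Properties using (∈-map⁺; ∈-map⁻; ∈-allFin)
import Data.List.Membership.Setoid as SetoidMembership
open import Data.List.Properties using (length-map; length-removeAt′; length-tabulate)
open import Data.List.Relation.Unary.All as All using (All; []; _∷_)
import Data.List.Relation.Unary.All.Properties as Allₚ
open import Data.List.Relation.Unary.AllPairs as AllPairs using ([]; _∷_)
import Data.List.Relation.Unary.AllPairs.Properties as AllPairsₚ
open import Data.List.Relation.Unary.Any as Any using (Any; here; there; _─_)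
import Data.List.Relation.Unary.Any.Properties as Anyₚ
open import Data.List.Relation.Unary.Unique.Propositional using (Unique)
import Data.List.Relation.Unary.Unique.Propositional.Properties as Uniqueₚ
import Data.List.Relation.Unary.Unique.Setoid as SetoidUnique
open import Data.Nat using (ℕ; zero; suc; _+_; _*_; _≤_; _<_; z≤n; s≤s)
open import Data.Nat.Properties
import Algebra.Properties.CommutativeMonoid.Sum +-0-commutativeMonoid as Sum
open import Data.Product using (∃; _×_; _,_; proj₁; proj₂; map₂)
open import Data.Sum using (inj₁; inj₂)
open import Data.Vec using ([]; _∷_; lookup; updateAt; replicate; tabulate)
open import Data.Vec.Properties
  using (≡-dec; lookup-zipWith; lookup∘tabulate; lookup-replicate; lookup∘updateAt; lookup∘updateAt′)
open import Data.Vec.Relation.Binary.Pointwise.Extensional using (ext; Pointwise-≡⇒≡)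
open import Function using (_∘_)
open import Function.Bundles using (_⇔_; mk⇔)
open import Relation.Binary.Bundles using (Setoid)
open import Relation.Binary.PropositionalEquality
open import Relation.Nullary using (¬_; contradiction; yes; no)

-- Hamming distance and coordinate flips

flipAt : ∀ {n} → Fin n → Vertex n → Vertex n
flipAt j x = updateAt x j not

differsAt : ∀ {n} → Vertex n → Vertex n → Fin n → Bool
differsAt x y j = lookup x j xor lookup y j

hamming-self : ∀ {n} (x : Vertex n) → hamming x x ≡ 0
hamming-self [] = refl
hamming-self (true ∷ x) = hamming-self x
hamming-self (false ∷ x) = hamming-self x

hamming-sym : ∀ {n} (x y : Vertex n) → hamming x y ≡ hamming y x
hamming-sym [] [] = refl
hamming-sym (true ∷ x) (true ∷ y) = hamming-sym x y
hamming-sym (true ∷ x) (false ∷ y) = cong suc (hamming-sym x y)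
hamming-sym (false ∷ x) (true ∷ y) = cong suc (hamming-sym x y)
hamming-sym (false ∷ x) (false ∷ y) = hamming-sym x y

hamming≡0⇒≡ : ∀ {n} (x y : Vertex n) → hamming x y ≡ 0 → x ≡ y
hamming≡0⇒≡ [] [] _ = refl
hamming≡0⇒≡ (true ∷ x) (true ∷ y) e = cong (true ∷_) (hamming≡0⇒≡ x y e)
hamming≡0⇒≡ (false ∷ x) (false ∷ y) e = cong (false ∷_) (hamming≡0⇒≡ x y e)

hamming-triangle : ∀ {n} (x y z : Vertex n) → hamming x z ≤ hamming x y + hamming y z
hamming-triangle [] [] [] = z≤n
hamming-triangle (true ∷ x) (true ∷ y) (true ∷ z) = hamming-triangle x y z
hamming-triangle (false ∷ x) (false ∷ y) (false ∷ z) = hamming-triangle x y z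
hamming-triangle (true ∷ x) (false ∷ y) (false ∷ z) = s≤s (hamming-triangle x y z)
hamming-triangle (false ∷ x) (true ∷ y) (true ∷ z) = s≤s (hamming-triangle x y z)
hamming-triangle (true ∷ x) (true ∷ y) (false ∷ z) =
  ≤-trans (s≤s (hamming-triangle x y z)) (≤-reflexive (sym (+-suc _ _)))
hamming-triangle (false ∷ x) (false ∷ y) (true ∷ z) =
  ≤-trans (s≤s (hamming-triangle x y z)) (≤-reflexive (sym (+-suc _ _)))
hamming-triangle (true ∷ x) (false ∷ y) (true ∷ z) =
  ≤-trans (hamming-triangle x y z) (+-mono-≤ (n≤1+n _) (n≤1+n _))
hamming-triangle (false ∷ x) (true ∷ y) (false ∷ z) =
  ≤-trans (hamming-triangle x y z) (+-mono-≤ (n≤1+n _) (n≤1+n _))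

hamming-flipAt-differing : ∀ {n} (x y : Vertex n) j → differsAt x y j ≡ true →
                           suc (hamming x (flipAt j y)) ≡ hamming x y
hamming-flipAt-differing (true ∷ x) (false ∷ y) zero _ = refl
hamming-flipAt-differing (false ∷ x) (true ∷ y) zero _ = refl
hamming-flipAt-differing (true ∷ x) (true ∷ y) (suc j) d = hamming-flipAt-differing x y j d
hamming-flipAt-differing (true ∷ x) (false ∷ y) (suc j) d = cong suc (hamming-flipAt-differing x y j d)
hamming-flipAt-differing (false ∷ x) (true ∷ y) (suc j) d = cong suc (hamming-flipAt-differing x y j d)
hamming-flipAt-differing (false ∷ x) (false ∷ y) (suc j) d = hamming-flipAt-differing x y j d

hamming-flipAt-agreeing : ∀ {n} (x y : Vertex n) j → differsAt x y j ≡ false →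
                          hamming x (flipAt j y) ≡ suc (hamming x y)
hamming-flipAt-agreeing (true ∷ x) (true ∷ y) zero _ = refl
hamming-flipAt-agreeing (false ∷ x) (false ∷ y) zero _ = refl
hamming-flipAt-agreeing (true ∷ x) (true ∷ y) (suc j) d = hamming-flipAt-agreeing x y j d
hamming-flipAt-agreeing (true ∷ x) (false ∷ y) (suc j) d = cong suc (hamming-flipAt-agreeing x y j d)
hamming-flipAt-agreeing (false ∷ x) (true ∷ y) (suc j) d = cong suc (hamming-flipAt-agreeing x y j d)
hamming-flipAt-agreeing (false ∷ x) (false ∷ y) (suc j) d = hamming-flipAt-agreeing x y j d

hamming-flipAt≢ : ∀ {n} (x y : Vertex n) j → hamming x (flipAt j y) ≢ hamming x y
hamming-flipAt≢ x y j with differsAt x y j in d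
... | true  = λ e → 1+n≢n (trans (hamming-flipAt-differing x y j d) (sym e))
... | false = λ e → 1+n≢n (trans (sym (hamming-flipAt-agreeing x y j d)) e)

hamming-flipAt≤ : ∀ {n} (x y : Vertex n) j → hamming x (flipAt j y) ≤ suc (hamming x y)
hamming-flipAt≤ x y j with differsAt x y j in d
... | true  = m≤n⇒m≤1+n (≤-trans (n≤1+n _) (≤-reflexive (hamming-flipAt-differing x y j d)))
... | false = ≤-reflexive (hamming-flipAt-agreeing x y j d)

hamming-flipAt<⇒differsAt : ∀ {n} (x y : Vertex n) j →
                            hamming x (flipAt j y) < hamming x y → differsAt x y j ≡ true
hamming-flipAt<⇒differsAt x y j closer with differsAt x y j in d
... | true  = refl
... | false = contradiction closer (<-asym (≤-reflexive (sym (hamming-flipAt-agreeing x y j d))))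

hamming-flipAt : ∀ {n} (x : Vertex n) j → hamming x (flipAt j x) ≡ 1
hamming-flipAt x j =
  trans (hamming-flipAt-agreeing x x j (xor-same (lookup x j))) (cong suc (hamming-self x))

hamming-suc⇒differsAt : ∀ {n m} (x y : Vertex n) → hamming x y ≡ suc m →
                        ∃ λ j → differsAt x y j ≡ true
hamming-suc⇒differsAt [] [] ()
hamming-suc⇒differsAt (true ∷ x) (false ∷ y) _ = zero , refl
hamming-suc⇒differsAt (false ∷ x) (true ∷ y) _ = zero , refl
hamming-suc⇒differsAt (true ∷ x) (true ∷ y) e = let j , d = hamming-suc⇒differsAt x y e in suc j , d
hamming-suc⇒differsAt (false ∷ x) (false ∷ y) e = let j , d = hamming-suc⇒differsAt x y e in suc j , d

hamming-step : ∀ {n m} (x y : Vertex n) → hamming x y ≡ suc m → ∃ λ j → hamming (flipAt j x) y ≡ m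
hamming-step {m = m} x y e with hamming-suc⇒differsAt y x (trans (hamming-sym y x) e)
... | j , d = j , suc-injective (begin
  suc (hamming (flipAt j x) y) ≡⟨ cong suc (hamming-sym (flipAt j x) y) ⟩
  suc (hamming y (flipAt j x)) ≡⟨ hamming-flipAt-differing y x j d ⟩
  hamming y x                  ≡⟨ hamming-sym y x ⟩
  hamming x y                  ≡⟨ e ⟩
  suc m                        ∎)
  where open ≡-Reasoning

hamming≡1⇒flipAt : ∀ {n} (x y : Vertex n) → hamming x y ≡ 1 → ∃ λ j → y ≡ flipAt j x
hamming≡1⇒flipAt x y e =
  let j , e′ = hamming-step x y e in j , sym (hamming≡0⇒≡ (flipAt j x) y e′)

hamming-split : ∀ {n} a b (x y : Vertex n) → hamming x y ≡ a + b →
                ∃ λ v → hamming x v ≡ a × hamming v y ≡ b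
hamming-split zero b x y e = x , hamming-self x , e
hamming-split (suc a) b x y e with hamming-step x y e
... | j , e′ with hamming-split a b (flipAt j x) y e′
... | v , x-v≡a , v-y≡b = v , ≤-antisym upper lower , v-y≡b
  where
  upper : hamming x v ≤ suc a
  upper = ≤-trans (hamming-triangle x (flipAt j x) v)
                  (≤-reflexive (cong₂ _+_ (hamming-flipAt x j) x-v≡a))
  lower : suc a ≤ hamming x v
  lower = +-cancelʳ-≤ b _ _ (≤-trans (≤-reflexive (sym e))
            (≤-trans (hamming-triangle x v y) (≤-reflexive (cong (hamming x v +_) v-y≡b))))

flipAt-injective : ∀ {n} (x : Vertex n) {i j} → flipAt i x ≡ flipAt j x → i ≡ j
flipAt-injective (true ∷ x) {zero} {zero} _ = refl
flipAt-injective (false ∷ x) {zero} {zero} _ = refl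
flipAt-injective (b ∷ x) {suc i} {suc j} e = cong suc (flipAt-injective x (cong Data.Vec.tail e))
flipAt-injective (true ∷ x) {zero} {suc j} ()
flipAt-injective (false ∷ x) {zero} {suc j} ()
flipAt-injective (true ∷ x) {suc i} {zero} ()
flipAt-injective (false ∷ x) {suc i} {zero} ()

differingCoords : ∀ {n} → Vertex n → Vertex n → List (Fin n)
differingCoords [] [] = []
differingCoords (a ∷ x) (b ∷ y) with a xor b
... | true  = zero ∷ map suc (differingCoords x y)
... | false = map suc (differingCoords x y)

length-differingCoords : ∀ {n} (x y : Vertex n) → length (differingCoords x y) ≡ hamming x y
length-differingCoords [] [] = refl
length-differingCoords (a ∷ x) (b ∷ y) with a xor b
... | true  = cong suc (trans (length-map suc (differingCoords x y)) (length-differingCoords x y))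
... | false = trans (length-map suc (differingCoords x y)) (length-differingCoords x y)

differingCoords-unique : ∀ {n} (x y : Vertex n) → Unique (differingCoords x y)
differingCoords-unique [] [] = []
differingCoords-unique (a ∷ x) (b ∷ y) with a xor b
... | true  = Allₚ.map⁺ (All.universal (λ _ ()) _)
            ∷ Uniqueₚ.map⁺ Fin.suc-injective (differingCoords-unique x y)
... | false = Uniqueₚ.map⁺ Fin.suc-injective (differingCoords-unique x y)

∈-differingCoords⁺ : ∀ {n} (x y : Vertex n) j → differsAt x y j ≡ true → j ∈ differingCoords x y
∈-differingCoords⁺ (a ∷ x) (b ∷ y) zero d with a xor b
... | true = here refl
∈-differingCoords⁺ (a ∷ x) (b ∷ y) (suc j) d with a xor b
... | true  = there (∈-map⁺ suc (∈-differingCoords⁺ x y j d))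
... | false = ∈-map⁺ suc (∈-differingCoords⁺ x y j d)

suc∈map-suc⁻ : ∀ {n} {j : Fin n} {js} → suc j ∈ map suc js → j ∈ js
suc∈map-suc⁻ j∈ with ∈-map⁻ suc j∈
... | _ , k∈ , refl = k∈

∈-differingCoords⁻ : ∀ {n} (x y : Vertex n) j → j ∈ differingCoords x y → differsAt x y j ≡ true
∈-differingCoords⁻ (a ∷ x) (b ∷ y) zero j∈ with a xor b
... | true  = refl
... | false with ∈-map⁻ suc j∈
...   | _ , _ , ()
∈-differingCoords⁻ (a ∷ x) (b ∷ y) (suc j) j∈ with a xor b | j∈
... | true  | there j∈ = ∈-differingCoords⁻ x y j (suc∈map-suc⁻ j∈)
... | false | j∈       = ∈-differingCoords⁻ x y j (suc∈map-suc⁻ j∈)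

hamming-flipAt-∈differingCoords : ∀ {n} (x y : Vertex n) {j} → j ∈ differingCoords x y →
                                  suc (hamming x (flipAt j y)) ≡ hamming x y
hamming-flipAt-∈differingCoords x y {j} j∈ = hamming-flipAt-differing x y j (∈-differingCoords⁻ x y j j∈)

-- The action of Aut(Q_n)

xor-cancelʳ : ∀ a b → (a xor b) xor b ≡ a
xor-cancelʳ a b = trans (xor-assoc a b b) (trans (cong (a xor_) (xor-same b)) (xor-identityʳ a))

xor-cancel-common : ∀ a b c → (a xor c) xor (b xor c) ≡ a xor b
xor-cancel-common a b c = begin
  (a xor c) xor (b xor c) ≡⟨ cong ((a xor c) xor_) (xor-comm b c) ⟩
  (a xor c) xor (c xor b) ≡⟨ xor-assoc (a xor c) c b ⟨
  ((a xor c) xor c) xor b ≡⟨ cong (_xor b) (xor-cancelʳ a c) ⟩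
  a xor b                 ∎
  where open ≡-Reasoning

xor≡ˡ⇒false : ∀ a b → a xor b ≡ a → b ≡ false
xor≡ˡ⇒false a false _ = refl
xor≡ˡ⇒false true true ()
xor≡ˡ⇒false false true ()

vertex-ext : ∀ {n} {x y : Vertex n} → (∀ i → lookup x i ≡ lookup y i) → x ≡ y
vertex-ext x≗y = Pointwise-≡⇒≡ (ext x≗y)

lookup-act : ∀ {n} (k : Aut n) x i → lookup (act k x) i ≡ lookup x (perm k ⟨$⟩ʳ i) xor lookup (tr k) i
lookup-act k x i =
  trans (lookup-zipWith _xor_ i (tabulate xσ) (tr k)) (cong (_xor lookup (tr k) i) (lookup∘tabulate xσ i))
  where
  xσ : Fin _ → Bool
  xσ i = lookup x (perm k ⟨$⟩ʳ i)

act-≈idA : ∀ {n} (k : Aut n) x → k ≈A idA → act k x ≡ x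
act-≈idA k x (tr≡ , perm≗) = vertex-ext λ i → begin
  lookup (act k x) i                            ≡⟨ lookup-act k x i ⟩
  lookup x (perm k ⟨$⟩ʳ i) xor lookup (tr k) i  ≡⟨ cong₂ (λ j t → lookup x j xor lookup t i) (perm≗ i) tr≡ ⟩
  lookup x i xor lookup (replicate _ false) i   ≡⟨ cong (lookup x i xor_) (lookup-replicate i false) ⟩
  lookup x i xor false                          ≡⟨ xor-identityʳ (lookup x i) ⟩
  lookup x i                                    ∎
  where open ≡-Reasoning

act-· : ∀ {n} (a b : Aut n) x → act (a · b) x ≡ act b (act a x)
act-· a b x = vertex-ext pointwise
  where
  open ≡-Reasoning
  pointwise : ∀ i → lookup (act (a · b) x) i ≡ lookup (act b (act a x)) i
  pointwise i = let j = perm b ⟨$⟩ʳ i ; xσ = lookup x (perm a ⟨$⟩ʳ j) ; t = lookup (tr b) i in begin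
    lookup (act (a · b) x) i                  ≡⟨ lookup-act (a · b) x i ⟩
    xσ xor lookup (tr (a · b)) i              ≡⟨ cong (xσ xor_) (lookup∘tabulate _ i) ⟩
    xσ xor (lookup (tr a) j xor t)            ≡⟨ xor-assoc xσ (lookup (tr a) j) t ⟨
    (xσ xor lookup (tr a) j) xor t            ≡⟨ cong (_xor t) (lookup-act a x j) ⟨
    lookup (act a x) j xor t                  ≡⟨ lookup-act b (act a x) i ⟨
    lookup (act b (act a x)) i                ∎

act-⁻¹ : ∀ {n} (k : Aut n) x → act (k ⁻¹) (act k x) ≡ x
act-⁻¹ k x = vertex-ext pointwise
  where
  open ≡-Reasoning
  pointwise : ∀ i → lookup (act (k ⁻¹) (act k x)) i ≡ lookup x i
  pointwise i = let j = perm k ⟨$⟩ˡ i ; t = lookup (tr k) j in begin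
    lookup (act (k ⁻¹) (act k x)) i              ≡⟨ lookup-act (k ⁻¹) (act k x) i ⟩
    lookup (act k x) j xor lookup (tr (k ⁻¹)) i  ≡⟨ cong₂ _xor_ (lookup-act k x j) (lookup∘tabulate _ i) ⟩
    (lookup x (perm k ⟨$⟩ʳ j) xor t) xor t       ≡⟨ xor-cancelʳ _ t ⟩
    lookup x (perm k ⟨$⟩ʳ j)                     ≡⟨ cong (lookup x) (inverseʳ (perm k)) ⟩
    lookup x i                                   ∎

hamming≡sum : ∀ {n} (x y : Vertex n) → hamming x y ≡ Sum.sum (λ i → if differsAt x y i then 1 else 0)
hamming≡sum [] [] = refl
hamming≡sum (a ∷ x) (b ∷ y) with a xor b
... | true  = cong suc (hamming≡sum x y)
... | false = hamming≡sum x y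

hamming-act : ∀ {n} (k : Aut n) x y → hamming (act k x) (act k y) ≡ hamming x y
hamming-act k x y = begin
  hamming (act k x) (act k y)                        ≡⟨ hamming≡sum (act k x) (act k y) ⟩
  Sum.sum (bit ∘ differsAt (act k x) (act k y))      ≡⟨ Sum.sum-cong-≗ (cong bit ∘ differsAt-act) ⟩
  Sum.sum (λ i → bit (differsAt x y (perm k ⟨$⟩ʳ i))) ≡⟨ Sum.sum-permute (bit ∘ differsAt x y) (perm k) ⟨
  Sum.sum (bit ∘ differsAt x y)                      ≡⟨ hamming≡sum x y ⟨
  hamming x y                                        ∎
  where
  open ≡-Reasoning
  bit : Bool → ℕ
  bit b = if b then 1 else 0
  differsAt-act : ∀ i → differsAt (act k x) (act k y) i ≡ differsAt x y (perm k ⟨$⟩ʳ i)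
  differsAt-act i = trans (cong₂ _xor_ (lookup-act k x i) (lookup-act k y i))
    (xor-cancel-common (lookup x (perm k ⟨$⟩ʳ i)) (lookup y (perm k ⟨$⟩ʳ i)) (lookup (tr k) i))

act-flipAt : ∀ {n} (k : Aut n) a x → act k (flipAt a x) ≡ flipAt (perm k ⟨$⟩ˡ a) (act k x)
act-flipAt {n} k a x = vertex-ext pointwise
  where
  open ≡-Reasoning
  σ : Permutation′ n
  σ = perm k
  pointwise : ∀ i → lookup (act k (flipAt a x)) i ≡ lookup (flipAt (σ ⟨$⟩ˡ a) (act k x)) i
  pointwise i with σ ⟨$⟩ˡ a Fin.≟ i
  ... | yes refl = let t = lookup (tr k) i in begin
    lookup (act k (flipAt a x)) i            ≡⟨ lookup-act k (flipAt a x) i ⟩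
    lookup (flipAt a x) (σ ⟨$⟩ʳ i) xor t     ≡⟨ cong (λ j → lookup (flipAt a x) j xor t) (inverseʳ σ) ⟩
    lookup (flipAt a x) a xor t              ≡⟨ cong (_xor t) (lookup∘updateAt a x) ⟩
    not (lookup x a) xor t                   ≡⟨ not-distribˡ-xor (lookup x a) t ⟨
    not (lookup x a xor t)                   ≡⟨ cong (λ j → not (lookup x j xor t)) (inverseʳ σ) ⟨
    not (lookup x (σ ⟨$⟩ʳ i) xor t)          ≡⟨ cong not (lookup-act k x i) ⟨
    not (lookup (act k x) i)                 ≡⟨ lookup∘updateAt i (act k x) ⟨
    lookup (flipAt i (act k x)) i            ∎
  ... | no σ⁻¹a≢i = let t = lookup (tr k) i in begin
    lookup (act k (flipAt a x)) i            ≡⟨ lookup-act k (flipAt a x) i ⟩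
    lookup (flipAt a x) (σ ⟨$⟩ʳ i) xor t     ≡⟨ cong (_xor t) (lookup∘updateAt′ (σ ⟨$⟩ʳ i) a σi≢a x) ⟩
    lookup x (σ ⟨$⟩ʳ i) xor t                ≡⟨ lookup-act k x i ⟨
    lookup (act k x) i                       ≡⟨ lookup∘updateAt′ i (σ ⟨$⟩ˡ a) (σ⁻¹a≢i ∘ sym) (act k x) ⟨
    lookup (flipAt (σ ⟨$⟩ˡ a) (act k x)) i   ∎
    where
    σi≢a : σ ⟨$⟩ʳ i ≢ a
    σi≢a σi≡a = σ⁻¹a≢i (trans (cong (σ ⟨$⟩ˡ_) (sym σi≡a)) (inverseˡ σ))

fixing-nontrivial⇒moves-coordinate : ∀ {n} (k : Aut n) x → act k x ≡ x → NonTrivial k →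
                                     ∃ λ i → perm k ⟨$⟩ʳ i ≢ i
fixing-nontrivial⇒moves-coordinate {n} k x kx≡x nontrivial =
  Fin.¬∀⟶∃¬ n _ (λ i → perm k ⟨$⟩ʳ i Fin.≟ i) (λ σ≗id → nontrivial (tr≡false σ≗id , σ≗id))
  where
  open ≡-Reasoning
  tr≡false : (∀ i → perm k ⟨$⟩ʳ i ≡ i) → tr k ≡ replicate n false
  tr≡false σ≗id = vertex-ext λ i → trans
    (xor≡ˡ⇒false (lookup x i) (lookup (tr k) i) (begin
      lookup x i xor lookup (tr k) i                ≡⟨ cong (λ j → lookup x j xor lookup (tr k) i) (σ≗id i) ⟨
      lookup x (perm k ⟨$⟩ʳ i) xor lookup (tr k) i  ≡⟨ lookup-act k x i ⟨
      lookup (act k x) i                            ≡⟨ cong (λ z → lookup z i) kx≡x ⟩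
      lookup x i                                    ∎))
    (sym (lookup-replicate i false))

allFinExcept : ∀ {n} → Fin n → List (Fin n)
allFinExcept {suc n} j = map (punchIn j) (allFin n)

length-allFinExcept : ∀ {n} (j : Fin n) → suc (length (allFinExcept j)) ≡ n
length-allFinExcept {suc n} j = cong suc (trans (length-map _ (allFin n)) (length-tabulate (λ i → i)))

∈-allFinExcept : ∀ {n} {i j : Fin n} → i ≢ j → i ∈ allFinExcept j
∈-allFinExcept {suc n} {i} {j} i≢j =
  subst (_∈ allFinExcept j) (Fin.punchIn-punchOut (i≢j ∘ sym)) (∈-map⁺ (punchIn j) (∈-allFin _))

module _ {c ℓ} (S : Setoid c ℓ) where
  open Setoid S using (_≉_) renaming (trans to ≈-trans; sym to ≈-sym)
  open SetoidMembership S using () renaming (_∈_ to _∈ₛ_)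

  ∈ₛ-─⁺ : ∀ {x y ys} (x∈ys : x ∈ₛ ys) → y ∈ₛ ys → x ≉ y → y ∈ₛ (ys ─ x∈ys)
  ∈ₛ-─⁺ (here x≈z) (here y≈z) x≉y = contradiction (≈-trans x≈z (≈-sym y≈z)) x≉y
  ∈ₛ-─⁺ (here _) (there y∈ys) _ = y∈ys
  ∈ₛ-─⁺ (there _) (here y≈z) _ = here y≈z
  ∈ₛ-─⁺ (there x∈ys) (there y∈ys) x≉y = there (∈ₛ-─⁺ x∈ys y∈ys x≉y)

  unique⊆⇒length≤ : ∀ {xs ys} → SetoidUnique.Unique S xs → All (_∈ₛ ys) xs → length xs ≤ length ys
  unique⊆⇒length≤ [] [] = z≤n
  unique⊆⇒length≤ {_ ∷ xs} {ys} (x≉xs ∷ xs!) (x∈ys ∷ xs⊆ys) = begin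
    suc (length xs)           ≤⟨ s≤s (unique⊆⇒length≤ xs! xs⊆ys─x) ⟩
    suc (length (ys ─ x∈ys))  ≡⟨ length-removeAt′ ys _ ⟨
    length ys                 ∎
    where
    open ≤-Reasoning
    xs⊆ys─x : All (_∈ₛ (ys ─ x∈ys)) xs
    xs⊆ys─x = All.zipWith (λ (x≉y , y∈ys) → ∈ₛ-─⁺ x∈ys y∈ys x≉y) (x≉xs , xs⊆ys)

data Parity : ℕ → Set where
  even : ∀ i → Parity (i + i)
  odd  : ∀ i → Parity (i + suc i)

parity : ∀ d → Parity d
parity zero = even 0
parity (suc d) with parity d
... | even i = subst Parity (+-suc i i) (odd i)
... | odd i  = even (suc i)

2*-as-+ : ∀ m → 2 * m ≡ m + m
2*-as-+ m = cong (m +_) (+-identityʳ m)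

halve-≤ : ∀ {m ℓ} → m + m ≤ 2 * ℓ → m ≤ ℓ
halve-≤ {m} {ℓ} 2m≤2ℓ = *-cancelˡ-≤ 2 (subst (_≤ 2 * ℓ) (sym (2*-as-+ m)) 2m≤2ℓ)

halve-< : ∀ {m ℓ} → m + suc m ≤ 2 * ℓ → m < ℓ
halve-< {m} {ℓ} 2m+1≤2ℓ = *-cancelˡ-< 2 m ℓ (begin-strict
  2 * m      ≡⟨ 2*-as-+ m ⟩
  m + m      <⟨ +-monoʳ-< m (n<1+n m) ⟩
  m + suc m  ≤⟨ 2m+1≤2ℓ ⟩
  2 * ℓ      ∎)
  where open ≤-Reasoning

double-< : ∀ {m ℓ} → suc m ≤ ℓ → suc m + suc m < suc (2 * ℓ)
double-< {m} {ℓ} 1+m≤ℓ = s≤s (subst (suc m + suc m ≤_) (sym (2*-as-+ ℓ)) (+-mono-≤ 1+m≤ℓ 1+m≤ℓ))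

-- The normal quotient

-- Since act is not injective, vertices related by _~_, Adj, Walk or Dist cannot be inferred from a
-- proof of the relation; this is why they are often passed explicitly below.
module NormalQuotient {n : ℕ} (K : Subgroup n) where
  open Quotient K

  dK≥-mono : ∀ {d e} → e ≤ d → dK≥ n K d → dK≥ n K e
  dK≥-mono e≤d dK≥d x k k∈K nontrivial = ≤-trans e≤d (dK≥d x k k∈K nontrivial)

  ~-refl : ∀ {x} → x ~ x
  ~-refl {x} = idA , id∈ K , act-≈idA idA x (refl , λ _ → refl)

  ~-sym : ∀ {x y} → x ~ y → y ~ x
  ~-sym {x} (k , k∈K , refl) = k ⁻¹ , inv∈ K k∈K , act-⁻¹ k x

  ~-trans : ∀ {x y z} → x ~ y → y ~ z → x ~ z
  ~-trans {x} (a , a∈K , refl) (b , b∈K , refl) = a · b , mul∈ K a∈K b∈K , act-· a b x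

  orbitSetoid : Setoid _ _
  orbitSetoid = record
    { Carrier = Vertex n
    ; _≈_ = _~_
    ; isEquivalence = record
      { refl = ~-refl ; sym = λ {x} {y} → ~-sym {x} {y} ; trans = λ {x} {y} {z} → ~-trans {x} {y} {z} }
    }

  Adj-respˡ : ∀ {x x′ z} → x ~ x′ → Adj x z → Adj x′ z
  Adj-respˡ {x} {x′} x~x′ (x≁z , x₁ , z₁ , x~x₁ , z~z₁ , x₁-z₁≡1) =
    (λ x′~z → x≁z (~-trans {x} {x′} x~x′ x′~z)) , x₁ , z₁ ,
    ~-trans {x′} {x} (~-sym {x} {x′} x~x′) x~x₁ , z~z₁ , x₁-z₁≡1

  Adj⇒~flipAt : ∀ x {z} → Adj x z → ∃ λ j → z ~ flipAt j x
  Adj⇒~flipAt x {z} (_ , _ , z₁ , (k , k∈K , refl) , z~z₁ , kx-z₁≡1)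
    with hamming≡1⇒flipAt x (act (k ⁻¹) z₁) x-k⁻¹z₁≡1
    where
    x-k⁻¹z₁≡1 : hamming x (act (k ⁻¹) z₁) ≡ 1
    x-k⁻¹z₁≡1 = begin
      hamming x (act (k ⁻¹) z₁)
        ≡⟨ cong (λ x′ → hamming x′ (act (k ⁻¹) z₁)) (act-⁻¹ k x) ⟨
      hamming (act (k ⁻¹) (act k x)) (act (k ⁻¹) z₁)
        ≡⟨ hamming-act (k ⁻¹) (act k x) z₁ ⟩
      hamming (act k x) z₁
        ≡⟨ kx-z₁≡1 ⟩
      1 ∎
      where open ≡-Reasoning
  ... | j , k⁻¹z₁≡flipAt =
    j , ~-trans {z} {z₁} z~z₁ (subst (z₁ ~_) k⁻¹z₁≡flipAt (k ⁻¹ , inv∈ K k∈K , refl))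

  Walk-respˡ : ∀ i {x x′ y} → x ~ x′ → Walk i x y → Walk i x′ y
  Walk-respˡ zero {x} {x′} x~x′ x~y = ~-trans {x′} {x} (~-sym {x} {x′} x~x′) x~y
  Walk-respˡ (suc i) {x} {x′} x~x′ (z , x-z , z⇝y) = z , Adj-respˡ {x} {x′} x~x′ x-z , z⇝y

  Walk-respʳ : ∀ i {x y y′} → y ~ y′ → Walk i x y → Walk i x y′
  Walk-respʳ zero {x} {y} y~y′ x~y = ~-trans {x} {y} x~y y~y′
  Walk-respʳ (suc i) y~y′ (z , x-z , z⇝y) = z , x-z , Walk-respʳ i y~y′ z⇝y

  Dist-respˡ : ∀ {x x′ y m} → x ~ x′ → Dist x y m → Dist x′ y m
  Dist-respˡ {x} {x′} {m = m} x~x′ (x⇝y , minimal) =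
    Walk-respˡ m x~x′ x⇝y , λ j j<m x′⇝y → minimal j j<m (Walk-respˡ j (~-sym {x} {x′} x~x′) x′⇝y)

  Walk⇒close-representative : ∀ i {x y} → Walk i x y → ∃ λ y′ → y ~ y′ × hamming x y′ ≤ i
  Walk⇒close-representative zero {x} {y} x~y = x , ~-sym {x} {y} x~y , ≤-reflexive (hamming-self x)
  Walk⇒close-representative (suc i) {x} {y} (z , x-z , z⇝y)
    with Adj⇒~flipAt x x-z | Walk⇒close-representative i z⇝y
  ... | j , g , g∈K , gz≡flipAt | y′ , y~y′ , z-y′≤i =
    act g y′ , ~-trans {y} {y′} y~y′ (g , g∈K , refl) , x-gy′≤1+i
    where
    open ≤-Reasoning
    x-gy′≤1+i : hamming x (act g y′) ≤ suc i
    x-gy′≤1+i = begin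
      hamming x (act g y′)
        ≤⟨ hamming-triangle x (flipAt j x) (act g y′) ⟩
      hamming x (flipAt j x) + hamming (flipAt j x) (act g y′)
        ≡⟨ cong₂ _+_ (hamming-flipAt x j) (cong (λ w → hamming w (act g y′)) (sym gz≡flipAt)) ⟩
      1 + hamming (act g z) (act g y′)
        ≡⟨ cong suc (hamming-act g z y′) ⟩
      1 + hamming z y′
        ≤⟨ s≤s z-y′≤i ⟩
      suc i ∎

  module _ {d} (dK≥d : dK≥ n K d) where

    small-displacement⇒fixed : ∀ {g y} → mem K g → hamming y (act g y) < d → act g y ≡ y
    small-displacement⇒fixed {g} {y} g∈K small with ≡-dec _≟ᵇ_ (act g y) y
    ... | yes gy≡y = gy≡y
    ... | no gy≢y = contradiction (dK≥d y g g∈K (gy≢y ∘ act-≈idA g y)) (<⇒≱ small)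

    ~-close⇒≡ : ∀ {u a b} → a ~ b → hamming u a + hamming u b < d → a ≡ b
    ~-close⇒≡ {u} {a} (g , g∈K , refl) close = sym (small-displacement⇒fixed g∈K (begin-strict
      hamming a (act g a)                ≤⟨ hamming-triangle a u (act g a) ⟩
      hamming a u + hamming u (act g a)  ≡⟨ cong (_+ hamming u (act g a)) (hamming-sym a u) ⟩
      hamming u a + hamming u (act g a)  <⟨ close ⟩
      d                                  ∎))
      where open ≤-Reasoning

  module _ (dK≥3 : dK≥ n K 3) where

    hamming≡1⇒Adj : ∀ x y → hamming x y ≡ 1 → Adj x y
    hamming≡1⇒Adj x y x-y≡1 = x≁y , x , y , ~-refl {x} , ~-refl {y} , x-y≡1
      where
      open ≡-Reasoning
      x≁y : ¬ (x ~ y)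
      x≁y (g , g∈K , refl) = 1+n≢0 (begin
        1                    ≡⟨ x-y≡1 ⟨
        hamming x (act g x)  ≡⟨ cong (hamming x) (small-displacement⇒fixed dK≥3 g∈K
                                  (≤-<-trans (≤-reflexive x-y≡1) (s≤s (s≤s z≤n)))) ⟩
        hamming x x          ≡⟨ hamming-self x ⟩
        0                    ∎)

    hamming⇒Walk : ∀ i {x y} → hamming x y ≡ i → Walk i x y
    hamming⇒Walk zero {x} {y} x-y≡0 = subst (x ~_) (hamming≡0⇒≡ x y x-y≡0) (~-refl {x})
    hamming⇒Walk (suc i) {x} {y} x-y≡1+i with hamming-step x y x-y≡1+i
    ... | j , flip-y≡i = flipAt j x , hamming≡1⇒Adj x (flipAt j x) (hamming-flipAt x j) , hamming⇒Walk i flip-y≡i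

    Dist⇒representative : ∀ {u v m} → Dist u v m → ∃ λ v′ → v ~ v′ × hamming u v′ ≡ m
    Dist⇒representative {u} {v} {m} (u⇝v , minimal) with Walk⇒close-representative m u⇝v
    ... | v′ , v~v′ , u-v′≤m with m≤n⇒m<n∨m≡n u-v′≤m
    ...   | inj₂ u-v′≡m = v′ , v~v′ , u-v′≡m
    ...   | inj₁ u-v′<m =
      contradiction (Walk-respʳ _ (~-sym {v} {v′} v~v′) (hamming⇒Walk _ refl)) (minimal _ u-v′<m)

    ~-flipAt⇒≡ : ∀ {v i j} → flipAt i v ~ flipAt j v → i ≡ j
    ~-flipAt⇒≡ {v} {i} {j} flips~ = flipAt-injective v (~-close⇒≡ dK≥3 {v} flips~
      (≤-reflexive (cong suc (cong₂ _+_ (hamming-flipAt v i) (hamming-flipAt v j)))))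

    module _ {d} (dK≥d : dK≥ n K d) where

      hamming⇒Dist : ∀ {u v m} → hamming u v ≡ m → m + m ≤ d → Dist u v m
      hamming⇒Dist {u} {v} {m} u-v≡m 2m≤d = hamming⇒Walk m u-v≡m , no-shorter-walk
        where
        no-shorter-walk : ∀ j → j < m → ¬ Walk j u v
        no-shorter-walk j j<m u⇝v with Walk⇒close-representative j u⇝v
        ... | v′ , v~v′ , u-v′≤j = <⇒≱ (≤-<-trans u-v′≤j j<m) (≤-reflexive (begin
          m             ≡⟨ u-v≡m ⟨
          hamming u v   ≡⟨ cong (hamming u) (~-close⇒≡ dK≥d {u} v~v′ close) ⟩
          hamming u v′  ∎))
          where
          open ≡-Reasoning
          close : hamming u v + hamming u v′ < d
          close = <-≤-trans (+-mono-≤-< (≤-reflexive u-v≡m) (≤-<-trans u-v′≤j j<m)) 2m≤d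

      Dist⇒hamming≡ : ∀ {u w z m} → Dist u w m → w ~ z → hamming u z + m < d → hamming u z ≡ m
      Dist⇒hamming≡ {u} {w} {z} u-w≡m w~z close with Dist⇒representative u-w≡m
      ... | w′ , w~w′ , u-w′≡m = trans (cong (hamming u) z≡w′) u-w′≡m
        where
        z≡w′ : z ≡ w′
        z≡w′ = ~-close⇒≡ dK≥d {u} (~-trans {z} {w} (~-sym {w} {z} w~z) w~w′)
                 (subst (λ h → hamming u z + h < d) (sym u-w′≡m) close)

      flipAt∈Layer∩Nbr : ∀ u u′ v {m} j → u′ ~ u → hamming u′ (flipAt j v) ≡ m → m + m ≤ d →
                         Layer∩Nbr u v m (flipAt j v)
      flipAt∈Layer∩Nbr u u′ v j u′~u u′-flip≡m 2m≤d =
        Dist-respˡ {u′} {u} u′~u (hamming⇒Dist u′-flip≡m 2m≤d) ,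
        hamming≡1⇒Adj v (flipAt j v) (hamming-flipAt v j)

  flipsOf : Vertex n → List (Fin n) → List (Vertex n)
  flipsOf v = map (λ j → flipAt j v)

  ∈-flipsOf : ∀ {v} y {j js} → j ∈ js → y ~ flipAt j v → Any (y ~_) (flipsOf v js)
  ∈-flipsOf _ j∈js y~flip = Anyₚ.map⁺ (Any.map (λ { refl → y~flip }) j∈js)

  flipsOf-unique : dK≥ n K 3 → ∀ {v js} → Unique js → SetoidUnique.Unique orbitSetoid (flipsOf v js)
  flipsOf-unique dK≥3 js! = AllPairsₚ.map⁺ (AllPairs.map (λ i≢j → i≢j ∘ ~-flipAt⇒≡ dK≥3) js!)

  -- From d_K ≥ 2ℓ+1 to condition (i)

  dK≥3⇒regular : dK≥ n K 3 → Regular n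
  dK≥3⇒regular dK≥3 u =
    flipsOf u (allFin n) ,
    trans (length-map _ (allFin n)) (length-tabulate (λ j → j)) ,
    Allₚ.map⁺ (All.universal (λ j → hamming≡1⇒Adj dK≥3 u (flipAt j u) (hamming-flipAt u j)) (allFin n)) ,
    flipsOf-unique dK≥3 (Uniqueₚ.allFin⁺ n) ,
    λ y u-y → let j , y~flip = Adj⇒~flipAt u u-y in ∈-flipsOf y (∈-allFin j) y~flip

  module _ (dK≥3 : dK≥ n K 3) {d} (dK≥d : dK≥ n K d) where

    dK≥⇒a≡0 : ∀ {m} → suc m + m < d → a-eq m 0
    dK≥⇒a≡0 {m} bound u v u-v≡m = [] , refl , [] , [] , λ w w∈layer → contradiction w∈layer (layer-empty w)
      where
      layer-empty : ∀ w → ¬ Layer∩Nbr u v m w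
      layer-empty w (u-w≡m , v-w) with Dist⇒representative dK≥3 u-v≡m
      ... | v′ , v~v′ , u-v′≡m with Adj⇒~flipAt v′ (Adj-respˡ {v} {v′} v~v′ v-w)
      ... | j , w~flip =
        hamming-flipAt≢ u v′ j (trans (Dist⇒hamming≡ dK≥3 dK≥d u-w≡m w~flip close) (sym u-v′≡m))
        where
        close : hamming u (flipAt j v′) + m < d
        close = ≤-<-trans (+-monoˡ-≤ m (≤-trans (hamming-flipAt≤ u v′ j) (≤-reflexive (cong suc u-v′≡m))))
                          bound

    dK≥⇒c≡ : ∀ {m} → suc m + suc m < d → c-succ m (suc m)
    dK≥⇒c≡ {m} bound u v u-v≡1+m with Dist⇒representative dK≥3 u-v≡1+m
    ... | v′ , v~v′ , u-v′≡1+m =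
      flipsOf v′ js ,
      trans (length-map _ js) (trans (length-differingCoords u v′) u-v′≡1+m) ,
      Allₚ.map⁺ (All.tabulate in-layer) ,
      flipsOf-unique dK≥3 (differingCoords-unique u v′) ,
      complete
      where
      js : List (Fin n)
      js = differingCoords u v′
      in-layer : ∀ {j} → j ∈ js → Layer∩Nbr u v m (flipAt j v′)
      in-layer {j} j∈js = map₂ (Adj-respˡ {v′} {v} (~-sym {v} {v′} v~v′))
        (flipAt∈Layer∩Nbr dK≥3 dK≥d u u v′ j (~-refl {u})
          (suc-injective (trans (hamming-flipAt-∈differingCoords u v′ j∈js) u-v′≡1+m))
          (≤-trans (+-mono-≤ (n≤1+n m) (n≤1+n m)) (<⇒≤ bound)))
      complete : ∀ w → Layer∩Nbr u v m w → Any (w ~_) (flipsOf v′ js)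
      complete w (u-w≡m , v-w) with Adj⇒~flipAt v′ (Adj-respˡ {v} {v′} v~v′ v-w)
      ... | j , w~flip =
        ∈-flipsOf w (∈-differingCoords⁺ u v′ j (hamming-flipAt<⇒differsAt u v′ j closer)) w~flip
        where
        close : hamming u (flipAt j v′) + m < d
        close = ≤-<-trans (+-monoˡ-≤ m (≤-trans (hamming-flipAt≤ u v′ j) (≤-reflexive (cong suc u-v′≡1+m))))
                          (subst (_< d) (+-suc (suc m) m) bound)
        closer : hamming u (flipAt j v′) < hamming u v′
        closer = subst₂ _<_ (sym (Dist⇒hamming≡ dK≥3 dK≥d u-w≡m w~flip close)) (sym u-v′≡1+m) (n<1+n m)

  dK≥⇒conditionI : ∀ {ℓ} → 1 ≤ ℓ → dK≥ n K (suc (2 * ℓ)) → ConditionI n K ℓ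
  dK≥⇒conditionI 1≤ℓ dK≥2ℓ+1 =
    dK≥3⇒regular dK≥3 ,
    λ m 1+m≤ℓ → dK≥⇒a≡0 dK≥3 dK≥2ℓ+1 (≤-<-trans (+-monoʳ-≤ (suc m) (n≤1+n m)) (double-< 1+m≤ℓ)) ,
                dK≥⇒c≡ dK≥3 dK≥2ℓ+1 (double-< 1+m≤ℓ)
    where
    dK≥3 : dK≥ n K 3
    dK≥3 = dK≥-mono (double-< 1≤ℓ) dK≥2ℓ+1

  -- From condition (i) to d_K ≥ 2ℓ+1

  module _ (dK≥3 : dK≥ n K 3) {d} (dK≥d : dK≥ n K d) where

    odd-displacement⇒a≢0 : ∀ {m k x} → mem K k → hamming x (act k x) ≡ m + suc m → m + m ≤ d → ¬ a-eq m 0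
    odd-displacement⇒a≢0 {m} {k} {x} k∈K x-kx≡2m+1 2m≤d a≡0
      with hamming-split m (suc m) x (act k x) x-kx≡2m+1
    ... | v , x-v≡m , v-kx≡1+m with hamming-step v (act k x) v-kx≡1+m
    ... | j , flip-kx≡m with a≡0 x v (hamming⇒Dist dK≥3 dK≥d x-v≡m 2m≤d)
    ... | [] , _ , _ , _ , complete
      with complete (flipAt j v)
             (flipAt∈Layer∩Nbr dK≥3 dK≥d x (act k x) v j (~-sym {x} {act k x} (k , k∈K , refl))
                (trans (hamming-sym (act k x) (flipAt j v)) flip-kx≡m) 2m≤d)
    ... | ()

    even-displacement⇒c≢ : ∀ {m k x} → mem K k → hamming x (act k x) ≡ suc m + suc m → suc m + suc m ≤ d →
                           ¬ c-succ m (suc m)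
    even-displacement⇒c≢ {m} {k} {x} k∈K x-kx≡2m+2 2m+2≤d c≡1+m
      with hamming-split (suc m) (suc m) x (act k x) x-kx≡2m+2
    ... | v , x-v≡1+m , v-kx≡1+m with hamming-step v (act k x) v-kx≡1+m
    ... | c , flip-kx≡m with c≡1+m x v (hamming⇒Dist dK≥3 dK≥d x-v≡1+m 2m+2≤d)
    ... | zs , length≡1+m , _ , _ , complete = 1+n≰n (begin
      suc (suc m)                  ≡⟨ cong suc (trans (length-differingCoords x v) x-v≡1+m) ⟨
      suc (length js)              ≡⟨ length-map _ (c ∷ js) ⟨
      length (flipsOf v (c ∷ js))  ≤⟨ unique⊆⇒length≤ orbitSetoid candidates! (All.map (complete _) in-layer) ⟩
      length zs                    ≡⟨ length≡1+m ⟩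
      suc m                        ∎)
      where
      open ≤-Reasoning
      js : List (Fin n)
      js = differingCoords x v
      2m≤d : m + m ≤ d
      2m≤d = ≤-trans (+-mono-≤ (n≤1+n m) (n≤1+n m)) 2m+2≤d
      x-flip≡m : ∀ {j} → j ∈ js → hamming x (flipAt j v) ≡ m
      x-flip≡m j∈js = suc-injective (trans (hamming-flipAt-∈differingCoords x v j∈js) x-v≡1+m)
      c∉js : c ∉ js
      c∉js c∈js = <⇒≱ (subst₂ _<_ (cong₂ _+_ (sym (x-flip≡m c∈js)) (sym flip-kx≡m)) (sym x-kx≡2m+2)
                                  (s≤s (+-monoʳ-≤ m (n≤1+n m))))
                       (hamming-triangle x (flipAt c v) (act k x))
      candidates! : SetoidUnique.Unique orbitSetoid (flipsOf v (c ∷ js))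
      candidates! = flipsOf-unique dK≥3
        (All.tabulate (λ { c′∈js refl → c∉js c′∈js }) ∷ differingCoords-unique x v)
      in-layer : All (Layer∩Nbr x v m) (flipsOf v (c ∷ js))
      in-layer = Allₚ.map⁺
        ( flipAt∈Layer∩Nbr dK≥3 dK≥d x (act k x) v c (~-sym {x} {act k x} (k , k∈K , refl))
            (trans (hamming-sym (act k x) (flipAt c v)) flip-kx≡m) 2m≤d
        ∷ All.tabulate (λ {j} j∈js →
            flipAt∈Layer∩Nbr dK≥3 dK≥d x x v j (~-refl {x}) (x-flip≡m j∈js) 2m≤d))

  module _ (regular : Regular n) where

    -- Pigeonhole: otherwise the n orbits adjacent to u would be covered by n - 1 flips of u.
    regular⇒flips-needed : ∀ u j → ¬ (∀ y → Adj u y → ∃ λ i → i ≢ j × y ~ flipAt i u)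
    regular⇒flips-needed u j cover with regular u
    ... | ys , length≡n , adj , ys! , _ = 1+n≰n (begin
      suc (length (allFinExcept j))        ≡⟨ length-allFinExcept j ⟩
      n                                    ≡⟨ length≡n ⟨
      length ys                            ≤⟨ unique⊆⇒length≤ orbitSetoid ys! (All.map covered adj) ⟩
      length (flipsOf u (allFinExcept j))  ≡⟨ length-map _ (allFinExcept j) ⟩
      length (allFinExcept j)              ∎)
      where
      open ≤-Reasoning
      covered : ∀ {y} → Adj u y → Any (y ~_) (flipsOf u (allFinExcept j))
      covered {y} u-y = let i , i≢j , y~flip = cover y u-y in ∈-flipsOf y (∈-allFinExcept i≢j) y~flip

    regular⇒≁flipAt : ∀ u j → ¬ (u ~ flipAt j u)
    regular⇒≁flipAt u j u~flip = regular⇒flips-needed u j cover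
      where
      cover : ∀ y → Adj u y → ∃ λ i → i ≢ j × y ~ flipAt i u
      cover y u-y with Adj⇒~flipAt u u-y
      ... | i , y~flip with i Fin.≟ j
      ...   | yes refl = contradiction (~-trans {u} {flipAt i u} u~flip (~-sym {y} {flipAt i u} y~flip)) (proj₁ u-y)
      ...   | no i≢j = i , i≢j , y~flip

    regular⇒flipAt-≁ : ∀ u {i j} → i ≢ j → ¬ (flipAt i u ~ flipAt j u)
    regular⇒flipAt-≁ u {i} {j} i≢j flips~ = regular⇒flips-needed u j cover
      where
      cover : ∀ y → Adj u y → ∃ λ k → k ≢ j × y ~ flipAt k u
      cover y u-y with Adj⇒~flipAt u u-y
      ... | k , y~flip with k Fin.≟ j
      ...   | yes refl = i , i≢j , ~-trans {y} {flipAt k u} y~flip (~-sym {flipAt i u} {flipAt k u} flips~)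
      ...   | no k≢j = k , k≢j , y~flip

    regular⇒semiregular : ∀ {k x} → mem K k → NonTrivial k → act k x ≢ x
    regular⇒semiregular {k} {x} k∈K nontrivial kx≡x with fixing-nontrivial⇒moves-coordinate k x kx≡x nontrivial
    ... | i , σi≢i = regular⇒flipAt-≁ x σi≢i (k , k∈K , (begin
      act k (flipAt (perm k ⟨$⟩ʳ i) x)                  ≡⟨ act-flipAt k (perm k ⟨$⟩ʳ i) x ⟩
      flipAt (perm k ⟨$⟩ˡ (perm k ⟨$⟩ʳ i)) (act k x)    ≡⟨ cong₂ flipAt (inverseˡ (perm k)) kx≡x ⟩
      flipAt i x                                        ∎))
      where open ≡-Reasoning

    regular⇒displacement≢1 : ∀ {k x} → mem K k → hamming x (act k x) ≢ 1
    regular⇒displacement≢1 {k} {x} k∈K x-kx≡1 with hamming≡1⇒flipAt x (act k x) x-kx≡1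
    ... | j , kx≡flip = regular⇒≁flipAt x j (k , k∈K , kx≡flip)

    regular⇒displacement≢2 : ∀ {k x} → mem K k → hamming x (act k x) ≢ 2
    regular⇒displacement≢2 {k} {x} k∈K x-kx≡2 with hamming-split 1 1 x (act k x) x-kx≡2
    ... | v , x-v≡1 , v-kx≡1
      with hamming≡1⇒flipAt v x (trans (hamming-sym v x) x-v≡1) | hamming≡1⇒flipAt v (act k x) v-kx≡1
    ... | i , x≡flip | j , kx≡flip with i Fin.≟ j
    ...   | no i≢j = regular⇒flipAt-≁ v i≢j (subst (_~ flipAt j v) x≡flip (k , k∈K , kx≡flip))
    ...   | yes refl = 1+n≢0 (begin
      2                    ≡⟨ x-kx≡2 ⟨
      hamming x (act k x)  ≡⟨ cong (hamming x) (trans kx≡flip (sym x≡flip)) ⟩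
      hamming x x          ≡⟨ hamming-self x ⟩
      0                    ∎)
      where open ≡-Reasoning

  conditionI⇒displacement≢ : ∀ {ℓ d k x} → ConditionI n K ℓ → d ≤ 2 * ℓ → dK≥ n K d →
                             mem K k → NonTrivial k → hamming x (act k x) ≢ d
  conditionI⇒displacement≢ {d = d} {k} {x} (regular , layers) d≤2ℓ dK≥d k∈K nontrivial with parity d
  ... | even 0 = λ x-kx≡0 →
    regular⇒semiregular regular k∈K nontrivial (sym (hamming≡0⇒≡ x (act k x) x-kx≡0))
  ... | odd 0  = regular⇒displacement≢1 regular {k} {x} k∈K
  ... | even 1 = regular⇒displacement≢2 regular {k} {x} k∈K
  ... | odd (suc i) = λ x-kx≡d →
    odd-displacement⇒a≢0 (dK≥-mono (+-mono-≤ (s≤s z≤n) (s≤s (s≤s z≤n))) dK≥d) dK≥d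
      {k = k} {x} k∈K x-kx≡d (+-monoʳ-≤ (suc i) (n≤1+n (suc i))) (proj₁ (layers (suc i) (halve-< d≤2ℓ)))
  ... | even (suc (suc i)) = λ x-kx≡d →
    even-displacement⇒c≢ (dK≥-mono (+-mono-≤ (s≤s (s≤s z≤n)) (s≤s z≤n)) dK≥d) dK≥d
      {k = k} {x} k∈K x-kx≡d ≤-refl (proj₂ (layers (suc i) (halve-≤ d≤2ℓ)))

  conditionI⇒dK≥ : ∀ {ℓ} → ConditionI n K ℓ → ∀ d → d ≤ suc (2 * ℓ) → dK≥ n K d
  conditionI⇒dK≥ C zero _ _ _ _ _ = z≤n
  conditionI⇒dK≥ C (suc d) 1+d≤2ℓ+1 x k k∈K nontrivial =
    ≤∧≢⇒< (dK≥d x k k∈K nontrivial)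
          (conditionI⇒displacement≢ {k = k} {x} C (≤-pred 1+d≤2ℓ+1) dK≥d k∈K nontrivial ∘ sym)
    where
    dK≥d : dK≥ n K d
    dK≥d = conditionI⇒dK≥ C d (≤-trans (n≤1+n d) 1+d≤2ℓ+1)

theorem1p2 : (n : ℕ) (K : Subgroup n) (ℓ : ℕ) → 1 ≤ ℓ →
    (ConditionI n K ℓ ⇔ dK≥ n K (suc (2 * ℓ)))
theorem1p2 n K ℓ 1≤ℓ = mk⇔ (λ C → conditionI⇒dK≥ C (suc (2 * ℓ)) ≤-refl) (dK≥⇒conditionI 1≤ℓ)
  where open NormalQuotient K
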